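{- The $\langle a\rangle$-coset subshift $X=\{\mathbf 1_{g\langle a\rangle}: g\in L\}\cup\{0^L\}\subseteq\{0,1\}^L$ on the lamplighter group $L$ is sofic.
   Context: **The group.** $L=\mathbb Z/2\wr\mathbb Z=\langle a,b\mid (a^nb^{ -n})^2\ (n\ge1)\rangle$, where $a$ is the generator of $\mathbb Z$. **Shifts and subshifts.** For a finite set $B$, the group $L$ acts on $B^L$ (with the product topology) by $(gx)_h=x_{g^{ -1}h}$. An SFT is a set of the form $\{y\in A^L: (y_{gw})_{w\in W}\in P\text{ for all }g\in L\}$ for a finite set $A$, a finite $W\subseteq L$ and $P\subseteq A^W$. A subset of $B^L$ is sofic if it is the image of an SFT under a continuous map commuting with the $L$-actions. **The subshift $X$.** Here $\mathbf 1_{g\langle a\rangle}$ denotes the indicator function of the left coset $g\langle a\rangle$; $X$ is the realization of the one-point compactification of $L/\langle a\rangle$. -}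

module Defs where

open import Data.Bool using (Bool; true; false)
open import Data.Nat using (ℕ; zero; suc; _∸_)
open import Data.Integer using (ℤ; +_; -[1+_]; _+_; _-_; -_; ∣_∣; _<?_; _≟_)
open import Data.List using (List; []; _∷_; foldr; length; lookup)
open import Data.List.Membership.Propositional using (_∈_)
open import Data.Fin using (Fin)
open import Data.Product using (Σ; ∃; _×_; _,_)
open import Data.Sum using (_⊎_)
open import Relation.Nullary using (yes; no)
open import Relation.Binary.PropositionalEquality using (_≡_)

-- Canonical finite subsets of ℤ (no proof components, so _≡_ is the
-- right equality): ∅, or (minimum element, list of gaps), where the
-- successive elements are z₀ , z₀ + 1 + g₀ , … .

data FinSetℤ : Set where
  ∅   : FinSetℤ
  set : ℤ → List ℕ → FinSetℤ

decode : FinSetℤ → List ℤ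
decode ∅ = []
decode (set z gs) = z ∷ go z gs
  where
  go : ℤ → List ℕ → List ℤ
  go z [] = []
  go z (g ∷ gs) = (z + + suc g) ∷ go (z + + suc g) gs

-- encode a strictly increasing list
encode : List ℤ → FinSetℤ
encode [] = ∅
encode (z ∷ zs) = set z (gaps z zs)
  where
  gaps : ℤ → List ℤ → List ℕ
  gaps z [] = []
  gaps z (w ∷ ws) = (∣ w - z ∣ ∸ 1) ∷ gaps w ws

toggle : ℤ → List ℤ → List ℤ
toggle z [] = z ∷ []
toggle z (w ∷ ws) with z <? w
... | yes _ = z ∷ w ∷ ws
... | no _ with z ≟ w
...   | yes _ = ws
...   | no _ = w ∷ toggle z ws

_△_ : FinSetℤ → FinSetℤ → FinSetℤ
S △ T = encode (foldr toggle (decode S) (decode T))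

shiftSet : ℤ → FinSetℤ → FinSetℤ
shiftSet p ∅ = ∅
shiftSet p (set z gs) = set (z + p) gs

-- The lamplighter group L = ℤ/2 ≀ ℤ : (set of lit lamps , position).

L : Set
L = FinSetℤ × ℤ

infixl 7 _·_
_·_ : L → L → L
(S , p) · (T , q) = (S △ shiftSet p T) , (p + q)

e : L
e = ∅ , + 0

_⁻¹ : L → L
(S , p) ⁻¹ = shiftSet (- p) S , - p

a : L
a = ∅ , + 1

b : L
b = set (+ 0) [] , + 0

powℕ : L → ℕ → L
powℕ g zero = e
powℕ g (suc n) = g · powℕ g n

pow : L → ℤ → L
pow g (+ n) = powℕ g n
pow g -[1+ n ] = powℕ (g ⁻¹) (suc n)

InCoset : L → L → Set
InCoset g h = ∃ λ (k : ℤ) → h ≡ g · pow a k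

shift : {B : Set} → L → (L → B) → (L → B)
shift g x h = x (g ⁻¹ · h)

record SFTData : Set where
  field
    n : ℕ
    W : List L
    P : (Fin (length W) → Fin n) → Bool

open SFTData public

InSFT : (D : SFTData) → (L → Fin (n D)) → Set
InSFT D y = ∀ (g : L) → P D (λ i → y (g · lookup (W D) i)) ≡ true

-- continuity (product topology, discrete alphabets) of φ restricted to the SFT:
-- each output coordinate is locally constant on the SFT.
ContinuousOn : (D : SFTData) → ((L → Fin (n D)) → (L → Bool)) → Set
ContinuousOn D φ =
  ∀ y → InSFT D y → ∀ (h : L) → ∃ λ (F : List L) →
    ∀ y' → InSFT D y' → (∀ u → u ∈ F → y' u ≡ y u) → φ y' h ≡ φ y h

EquivariantOn : (D : SFTData) → ((L → Fin (n D)) → (L → Bool)) → Set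
EquivariantOn D φ =
  ∀ (g : L) y → InSFT D y → ∀ (h : L) → φ (shift g y) h ≡ shift g (φ y) h

InImage : (D : SFTData) → ((L → Fin (n D)) → (L → Bool)) → (L → Bool) → Set
InImage D φ z = ∃ λ y → InSFT D y × (∀ h → φ y h ≡ z h)

-- a subset Z ⊆ {0,1}^L (as a predicate; Bool with true = 1) is sofic
Sofic : ((L → Bool) → Set) → Set
Sofic Z = Σ SFTData λ D → Σ ((L → Fin (n D)) → (L → Bool)) λ φ →
  ContinuousOn D φ × EquivariantOn D φ ×
  (∀ z → (Z z → InImage D φ z) × (InImage D φ z → Z z))

X : (L → Bool) → Set
X x = (∃ λ (g : L) → ∀ h → (x h ≡ true → InCoset g h) × (InCoset g h → x h ≡ true))
    ⊎ (∀ h → x h ≡ false)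

{-# OPTIONS --safe #-}

-- A point of the shift of finite type carries two bits at each (S , q) ∈ L: a mark, which the
-- factor map reads off, and an agreement bit, meant to say that S agrees with a fixed S₀ on
-- [q, ∞). The local rule makes the mark constant along cosets of ⟨a⟩ and imply the agreement
-- bit, makes the agreement bits at (S , q) and (switch q S , q) exclusive, and makes the bit at
-- (S , q) the disjunction of those at (S , q - 1) and (switch (q - 1) S , q - 1). Since lamp sets
-- are finite, induction on q shows that the agreement bit at (S , q) only depends on S ∩ [q, ∞);
-- with exclusivity, a downward induction then shows that at most one lamp set carries agreement
-- bits everywhere, so at most one coset is marked. Conversely, taking the agreement bit to be the
-- predicate itself realizes the indicator of S₀⟨a⟩. Excluded middle decides these predicates and
-- whether any mark is set.

module Submission where

open import Defs
open import Level using (0ℓ)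
open import Axiom.ExcludedMiddle using (ExcludedMiddle)

open import Data.Bool as Bool using (Bool; true; false; not; _∨_; T)
open import Data.Bool.Properties using (∨-comm; ¬-not; not-¬; T-≡)
open import Data.Fin using (Fin; zero; suc; #_)
open import Data.Integer
  using (ℤ; +_; -[1+_]; _+_; _-_; -_; ∣_∣; _<_; _≤_; _⊓_; _⊔_; pred; +<+; -≤+; _<?_; _≤?_; _≟_)
  renaming (suc to sucℤ)
open import Data.Integer.Properties
  using ( ≤-refl; ≤-reflexive; ≤-trans; <-trans; <⇒≤; <-≤-trans; ≤-<-trans
        ; <⇒≢; <⇒≱; ≰⇒>; ≮⇒≥; <-cmp
        ; +-comm; +-identityˡ; +-identityʳ; +-inverseʳ; +-monoˡ-<; +-monoʳ-<; +-monoʳ-≤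
        ; +-pred; pred-suc; suc-pred; pred-mono
        ; i≤pred[j]⇒i<j; i<j⇒i≤pred[j]; i<j⇒suc[i]≤j; suc[i]≤j⇒i<j
        ; i⊓j≤i; i⊓j≤j; i⊔j≤k⇒i≤k; i⊔j≤k⇒j≤k )
open import Data.Integer.Tactic.RingSolver using (solve-∀)
open import Data.List using (List; []; _∷_; lookup)
open import Data.List.Relation.Unary.All as All using (All; []; _∷_)
open import Data.List.Relation.Unary.AllPairs using (AllPairs; []; _∷_)
open import Data.List.Relation.Unary.Any using (here)
open import Data.Nat using (ℕ; zero; suc; _∸_; s≤s; z≤n)
open import Data.Product using (∃; _,_; proj₁; proj₂)
open import Data.Sum using (_⊎_; inj₁; inj₂)
open import Function using (_∘_)
open import Function.Bundles using (_⇔_; mk⇔; Equivalence)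
import Function.Properties.Equivalence as ⇔
open import Relation.Binary.Definitions using (tri<; tri≈; tri>)
open import Relation.Binary.PropositionalEquality
open import Relation.Nullary using (Dec; yes; no; ¬_; does; contradiction)
open import Relation.Nullary.Decidable
  using (map′; _×-dec_; _→-dec_; _⊎-dec_; ¬?; T?; dec-true; dec-false; does-⇔)

open Equivalence using (to; from)

-- Integer arithmetic

i<i+suc[n] : ∀ i n → i < i + + suc n
i<i+suc[n] i n = subst (_< i + + suc n) (+-identityʳ i) (+-monoʳ-< i (+<+ (s≤s z≤n)))

i≤+∣i∣ : ∀ i → i ≤ + ∣ i ∣
i≤+∣i∣ (+ n)    = ≤-refl
i≤+∣i∣ -[1+ n ] = -≤+

i≤j+∣i-j∣ : ∀ i j → i ≤ j + + ∣ i - j ∣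
i≤j+∣i-j∣ i j = subst (_≤ j + + ∣ i - j ∣) (j+[i-j]≡i i j) (+-monoʳ-≤ j (i≤+∣i∣ (i - j)))
  where
  j+[i-j]≡i : ∀ i j → j + (i - j) ≡ i
  j+[i-j]≡i = solve-∀

0<i⇒+suc[∣i∣∸1]≡i : ∀ {i} → + 0 < i → + suc (∣ i ∣ ∸ 1) ≡ i
0<i⇒+suc[∣i∣∸1]≡i {+ suc n} _ = refl
0<i⇒+suc[∣i∣∸1]≡i {+ zero} (+<+ ())

i<j⇒i+suc[∣j-i∣∸1]≡j : ∀ {i j} → i < j → i + + suc (∣ j - i ∣ ∸ 1) ≡ j
i<j⇒i+suc[∣j-i∣∸1]≡j {i} {j} i<j =
  trans (cong (λ d → i + d) (0<i⇒+suc[∣i∣∸1]≡i 0<j-i)) (i+[j-i]≡j i j)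
  where
  0<j-i : + 0 < j - i
  0<j-i = subst (_< j - i) (+-inverseʳ i) (+-monoˡ-< (- i) i<j)
  i+[j-i]≡j : ∀ i j → i + (j - i) ≡ j
  i+[j-i]≡j = solve-∀

pred<id : ∀ q → pred q < q
pred<id q = i≤pred[j]⇒i<j ≤-refl

≤⇒≢pred : ∀ {q r} → q ≤ r → r ≢ pred q
≤⇒≢pred {q} q≤r refl = <⇒≱ (pred<id q) q≤r

pred≤⇒≤⊎≡pred : ∀ {q r} → pred q ≤ r → q ≤ r ⊎ r ≡ pred q
pred≤⇒≤⊎≡pred {q} {r} pred[q]≤r with <-cmp (pred q) r
... | tri< p<r _ _ = inj₁ (subst (_≤ r) (suc-pred q) (i<j⇒suc[i]≤j p<r))
... | tri≈ _ p≡r _ = inj₂ (sym p≡r)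
... | tri> _ _ r<p = contradiction pred[q]≤r (<⇒≱ r<p)

ℤ-induction-above : (B : ℤ) (P : ℤ → Set) →
                    (∀ {q} → q ≤ B → P q) → (∀ {q} → B < q → P (pred q) → P q) → ∀ q → P q
ℤ-induction-above B P base step q = go ∣ q - B ∣ q (i≤j+∣i-j∣ q B)
  where
  go : ∀ n q → q ≤ B + + n → P q
  go zero    q q≤B+0 = base (subst (q ≤_) (+-identityʳ B) q≤B+0)
  go (suc n) q q≤B+n+1 with q ≤? B
  ... | yes q≤B = base q≤B
  ... | no  q≰B = step (≰⇒> q≰B) (go n (pred q) pred[q]≤B+n)
    where
    pred[q]≤B+n : pred q ≤ B + + n
    pred[q]≤B+n = subst (pred q ≤_) (sym (+-pred B (+ suc n))) (pred-mono q≤B+n+1)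

ℤ-induction-below : (U : ℤ) (P : ℤ → Set) →
                    (∀ {q} → U ≤ q → P q) → (∀ {q} → P q → P (pred q)) → ∀ q → P q
ℤ-induction-below U P top step q = go ∣ U - q ∣ q (i≤j+∣i-j∣ U q)
  where
  i+[1+j]≡[1+i]+j : ∀ i j → i + (+ 1 + j) ≡ (+ 1 + i) + j
  i+[1+j]≡[1+i]+j = solve-∀
  go : ∀ n q → U ≤ q + + n → P q
  go zero    q U≤q+0   = top (subst (U ≤_) (+-identityʳ q) U≤q+0)
  go (suc n) q U≤q+n+1 =
    subst P (pred-suc q) (step (go n (sucℤ q) (subst (U ≤_) (i+[1+j]≡[1+i]+j q (+ n)) U≤q+n+1)))

sucℤ-invariant⇒constant : ∀ {A : Set} (f : ℤ → A) → (∀ q → f q ≡ f (sucℤ q)) → ∀ q r → f q ≡ f r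
sucℤ-invariant⇒constant f inv q r = trans (≡f0 q) (sym (≡f0 r))
  where
  ≡f0 : ∀ q → f q ≡ f (+ 0)
  ≡f0 (+ zero)     = refl
  ≡f0 (+ suc n)    = trans (sym (inv (+ n))) (≡f0 (+ n))
  ≡f0 -[1+ zero ]  = inv -[1+ zero ]
  ≡f0 -[1+ suc n ] = trans (inv -[1+ suc n ]) (≡f0 -[1+ n ])

-- Strictly increasing lists of integers

Increasing : List ℤ → Set
Increasing = AllPairs _<_

elemᵇ : ℤ → List ℤ → Bool
elemᵇ r []       = false
elemᵇ r (x ∷ xs) = does (r ≟ x) ∨ elemᵇ r xs

elemᵇ-head : ∀ x xs → elemᵇ x (x ∷ xs) ≡ true
elemᵇ-head x xs rewrite dec-true (x ≟ x) refl = refl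

elemᵇ-∷-≢ : ∀ {r x} xs → r ≢ x → elemᵇ r (x ∷ xs) ≡ elemᵇ r xs
elemᵇ-∷-≢ {r} {x} xs r≢x rewrite dec-false (r ≟ x) r≢x = refl

elemᵇ-∉ : ∀ {r} xs → All (r ≢_) xs → elemᵇ r xs ≡ false
elemᵇ-∉ []       []             = refl
elemᵇ-∉ (x ∷ xs) (r≢x ∷ r∉xs) = trans (elemᵇ-∷-≢ xs r≢x) (elemᵇ-∉ xs r∉xs)

elemᵇ-below : ∀ {r x} xs → All (x <_) xs → r ≤ x → elemᵇ r xs ≡ false
elemᵇ-below xs x<xs r≤x = elemᵇ-∉ xs (All.map (λ x<y → <⇒≢ (≤-<-trans r≤x x<y)) x<xs)

elemᵇ-below-head : ∀ {r y} ys → All (y <_) ys → r < y → elemᵇ r (y ∷ ys) ≡ false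
elemᵇ-below-head ys y<ys r<y = elemᵇ-below (_ ∷ ys) (r<y ∷ All.map (<-trans r<y) y<ys) ≤-refl

elemᵇ-bounded-below : ∀ xs → ∃ λ B → ∀ {r} → r < B → elemᵇ r xs ≡ false
elemᵇ-bounded-below []       = + 0 , λ _ → refl
elemᵇ-bounded-below (x ∷ xs) with elemᵇ-bounded-below xs
... | B , below-B = x ⊓ B , λ r<x⊓B →
  trans (elemᵇ-∷-≢ xs (<⇒≢ (<-≤-trans r<x⊓B (i⊓j≤i x B))))
        (below-B (<-≤-trans r<x⊓B (i⊓j≤j x B)))

elemᵇ-bounded-above : ∀ xs → ∃ λ U → ∀ {r} → U ≤ r → elemᵇ r xs ≡ false
elemᵇ-bounded-above []       = + 0 , λ _ → refl
elemᵇ-bounded-above (x ∷ xs) with elemᵇ-bounded-above xs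
... | U , above-U = sucℤ x ⊔ U , λ x⊔U≤r →
  trans (elemᵇ-∷-≢ xs (≢-sym (<⇒≢ (suc[i]≤j⇒i<j (i⊔j≤k⇒i≤k (sucℤ x) U x⊔U≤r)))))
        (above-U (i⊔j≤k⇒j≤k (sucℤ x) U x⊔U≤r))

toggle-All : ∀ {x z} ws → All (x <_) ws → x < z → All (x <_) (toggle z ws)
toggle-All {z = z} []       []           x<z = x<z ∷ []
toggle-All {z = z} (w ∷ ws) (x<w ∷ x<ws) x<z with z <? w
... | yes _ = x<z ∷ x<w ∷ x<ws
... | no _ with z ≟ w
...   | yes _ = x<ws
...   | no _  = x<w ∷ toggle-All ws x<ws x<z

toggle-increasing : ∀ z ws → Increasing ws → Increasing (toggle z ws)
toggle-increasing z []       []                 = [] ∷ []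
toggle-increasing z (w ∷ ws) (w<ws ∷ inc-ws) with z <? w
... | yes z<w = (z<w ∷ All.map (<-trans z<w) w<ws) ∷ w<ws ∷ inc-ws
... | no z≮w with z ≟ w
...   | yes _   = inc-ws
...   | no z≢w = toggle-All ws w<ws (w<z z≮w z≢w) ∷ toggle-increasing z ws inc-ws
  where
  w<z : ¬ z < w → z ≢ w → w < z
  w<z z≮w z≢w with <-cmp z w
  ... | tri< z<w _ _ = contradiction z<w z≮w
  ... | tri≈ _ z≡w _ = contradiction z≡w z≢w
  ... | tri> _ _ w<z = w<z

elemᵇ-toggle-self : ∀ z ws → Increasing ws → elemᵇ z (toggle z ws) ≡ not (elemᵇ z ws)
elemᵇ-toggle-self z []       _                  = elemᵇ-head z []
elemᵇ-toggle-self z (w ∷ ws) (w<ws ∷ inc-ws) with z <? w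
... | yes z<w rewrite dec-true (z ≟ z) refl | dec-false (z ≟ w) (<⇒≢ z<w)
  = cong not (sym (elemᵇ-below ws w<ws (<⇒≤ z<w)))
... | no _ with z ≟ w
...   | yes z≡w = elemᵇ-below ws w<ws (≤-reflexive z≡w)
...   | no z≢w  = trans (elemᵇ-∷-≢ (toggle z ws) z≢w) (elemᵇ-toggle-self z ws inc-ws)

elemᵇ-toggle-other : ∀ {r z} ws → r ≢ z → elemᵇ r (toggle z ws) ≡ elemᵇ r ws
elemᵇ-toggle-other {r} {z} []       r≢z = elemᵇ-∷-≢ [] r≢z
elemᵇ-toggle-other {r} {z} (w ∷ ws) r≢z with z <? w
... | yes _ = elemᵇ-∷-≢ (w ∷ ws) r≢z
... | no _ with z ≟ w
...   | yes refl = sym (elemᵇ-∷-≢ ws r≢z)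
...   | no _     = cong (does (r ≟ w) ∨_) (elemᵇ-toggle-other ws r≢z)

increasing-ext : ∀ {xs ys} → Increasing xs → Increasing ys →
                 (∀ r → elemᵇ r xs ≡ elemᵇ r ys) → xs ≡ ys
increasing-ext {[]}     {[]}     _ _ _ = refl
increasing-ext {[]}     {y ∷ ys} _ _ same = contradiction (trans (same y) (elemᵇ-head y ys)) λ ()
increasing-ext {x ∷ xs} {[]}     _ _ same = contradiction (trans (sym (same x)) (elemᵇ-head x xs)) λ ()
increasing-ext {x ∷ xs} {y ∷ ys} (x<xs ∷ inc-xs) (y<ys ∷ inc-ys) same with <-cmp x y
... | tri< x<y _ _ =
  contradiction (trans (sym (elemᵇ-head x xs)) (trans (same x) (elemᵇ-below-head ys y<ys x<y))) λ ()
... | tri> _ _ y<x =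
  contradiction (trans (sym (elemᵇ-head y ys)) (trans (sym (same y)) (elemᵇ-below-head xs x<xs y<x))) λ ()
... | tri≈ _ refl _ = cong (x ∷_) (increasing-ext inc-xs inc-ys same-tail)
  where
  same-tail : ∀ r → elemᵇ r xs ≡ elemᵇ r ys
  same-tail r with r ≟ x
  ... | yes refl = trans (elemᵇ-below xs x<xs ≤-refl) (sym (elemᵇ-below ys y<ys ≤-refl))
  ... | no r≢x   = trans (sym (elemᵇ-∷-≢ xs r≢x)) (trans (same r) (elemᵇ-∷-≢ ys r≢x))

decode-set-lower : ∀ z gs → All (z ≤_) (decode (set z gs))
decode-set-lower z []       = ≤-refl ∷ []
decode-set-lower z (g ∷ gs) =
  ≤-refl ∷ All.map (≤-trans (<⇒≤ (i<i+suc[n] z g))) (decode-set-lower _ gs)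

decode-increasing : ∀ S → Increasing (decode S)
decode-increasing ∅          = []
decode-increasing (set z gs) = go z gs
  where
  go : ∀ z gs → Increasing (decode (set z gs))
  go z []       = [] ∷ []
  go z (g ∷ gs) = All.map (<-≤-trans (i<i+suc[n] z g)) (decode-set-lower _ gs) ∷ go _ gs

set-injectiveʳ : ∀ {z z′ gs gs′} → set z gs ≡ set z′ gs′ → gs ≡ gs′
set-injectiveʳ refl = refl

encode-decode : ∀ S → encode (decode S) ≡ S
encode-decode ∅          = refl
encode-decode (set z gs) = go z gs
  where
  i+j-i≡j : ∀ i j → i + j - i ≡ j
  i+j-i≡j = solve-∀
  go : ∀ z gs → encode (decode (set z gs)) ≡ set z gs
  go z []       = refl
  go z (g ∷ gs) = cong₂ (λ n ns → set z (n ∷ ns))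
                        (cong (λ d → ∣ d ∣ ∸ 1) (i+j-i≡j z (+ suc g)))
                        (set-injectiveʳ (go _ gs))

-- encode computes its gap list with a local function; gapsOf (encode (w ∷ ws)) is
-- definitionally that function applied to the tail, which lets decode-encode name it.
gapsOf : FinSetℤ → List ℕ
gapsOf ∅          = []
gapsOf (set _ gs) = gs

decode-encode : ∀ zs → Increasing zs → decode (encode zs) ≡ zs
decode-encode []           _                      = refl
decode-encode (z ∷ [])     _                      = refl
decode-encode (z ∷ w ∷ ws) ((z<w ∷ _) ∷ inc-w∷ws) = cong (z ∷_) (begin
  decode (set (z + + suc (∣ w - z ∣ ∸ 1)) gs)
    ≡⟨ cong (λ v → decode (set v gs)) (i<j⇒i+suc[∣j-i∣∸1]≡j z<w) ⟩
  decode (set w gs)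
    ≡⟨ decode-encode (w ∷ ws) inc-w∷ws ⟩
  w ∷ ws
    ∎)
  where
  open ≡-Reasoning
  gs : List ℕ
  gs = gapsOf (encode (w ∷ ws))

△-identityʳ : ∀ S → S △ ∅ ≡ S
△-identityʳ = encode-decode

lit : FinSetℤ → ℤ → Bool
lit S r = elemᵇ r (decode S)

lit-ext : ∀ {S T} → (∀ r → lit S r ≡ lit T r) → S ≡ T
lit-ext {S} {T} same = begin
  S                 ≡⟨ encode-decode S ⟨
  encode (decode S) ≡⟨ cong encode (increasing-ext (decode-increasing S) (decode-increasing T) same) ⟩
  encode (decode T) ≡⟨ encode-decode T ⟩
  T                 ∎
  where open ≡-Reasoning

lit-bounded-below : ∀ S → ∃ λ B → ∀ {r} → r < B → lit S r ≡ false
lit-bounded-below S = elemᵇ-bounded-below (decode S)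

lit-bounded-above : ∀ S → ∃ λ U → ∀ {r} → U ≤ r → lit S r ≡ false
lit-bounded-above S = elemᵇ-bounded-above (decode S)

switch : ℤ → FinSetℤ → FinSetℤ
switch p S = S △ set p []

decode-switch : ∀ p S → decode (switch p S) ≡ toggle p (decode S)
decode-switch p S =
  decode-encode (toggle p (decode S)) (toggle-increasing p (decode S) (decode-increasing S))

lit-switch-self : ∀ p S → lit (switch p S) p ≡ not (lit S p)
lit-switch-self p S rewrite decode-switch p S = elemᵇ-toggle-self p (decode S) (decode-increasing S)

lit-switch-other : ∀ {p r} S → r ≢ p → lit (switch p S) r ≡ lit S r
lit-switch-other {p} S r≢p rewrite decode-switch p S = elemᵇ-toggle-other (decode S) r≢p

-- Agreement of two sets on a region

record Agree (R : ℤ → Set) (S T : FinSetℤ) : Set where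
  constructor mkAgree
  field at : ∀ r → R r → lit S r ≡ lit T r

open Agree

AgreeFrom : ℤ → FinSetℤ → FinSetℤ → Set
AgreeFrom q = Agree (q ≤_)

AgreeBelow : ℤ → FinSetℤ → FinSetℤ → Set
AgreeBelow B = Agree (_< B)

module _ {R : ℤ → Set} where

  Agree-refl : ∀ {S} → Agree R S S
  Agree-refl = mkAgree λ _ _ → refl

  Agree-sym : ∀ {S T} → Agree R S T → Agree R T S
  Agree-sym S≈T = mkAgree λ r r∈R → sym (at S≈T r r∈R)

  Agree-trans : ∀ {S T U} → Agree R S T → Agree R T U → Agree R S U
  Agree-trans S≈T T≈U = mkAgree λ r r∈R → trans (at S≈T r r∈R) (at T≈U r r∈R)

  Agree-mono : ∀ {R′ : ℤ → Set} {S T} → (∀ {r} → R′ r → R r) → Agree R S T → Agree R′ S T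
  Agree-mono R′⊆R S≈T = mkAgree λ r r∈R′ → at S≈T r (R′⊆R r∈R′)

  Agree-switch : ∀ {p S T} → Agree R S T → Agree R (switch p S) (switch p T)
  Agree-switch {p} {S} {T} S≈T = mkAgree switched
    where
    switched : ∀ r → R r → lit (switch p S) r ≡ lit (switch p T) r
    switched r r∈R with r ≟ p
    ... | yes refl = begin
      lit (switch r S) r ≡⟨ lit-switch-self r S ⟩
      not (lit S r)      ≡⟨ cong not (at S≈T r r∈R) ⟩
      not (lit T r)      ≡⟨ lit-switch-self r T ⟨
      lit (switch r T) r ∎
      where open ≡-Reasoning
    ... | no r≢p = begin
      lit (switch p S) r ≡⟨ lit-switch-other S r≢p ⟩
      lit S r            ≡⟨ at S≈T r r∈R ⟩
      lit T r            ≡⟨ lit-switch-other T r≢p ⟨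
      lit (switch p T) r ∎
      where open ≡-Reasoning

  switch-Agree : ∀ {p S} → (∀ {r} → R r → r ≢ p) → Agree R (switch p S) S
  switch-Agree {S = S} p∉R = mkAgree λ r r∈R → lit-switch-other S (p∉R r∈R)

AgreeFrom-pred : ∀ {q S T} →
  AgreeFrom q S T → lit S (pred q) ≡ lit T (pred q) → AgreeFrom (pred q) S T
AgreeFrom-pred {q} {S} {T} S≈T same-at-pred = mkAgree extended
  where
  extended : ∀ r → pred q ≤ r → lit S r ≡ lit T r
  extended r pred[q]≤r with pred≤⇒≤⊎≡pred {q} pred[q]≤r
  ... | inj₁ q≤r  = at S≈T r q≤r
  ... | inj₂ refl = same-at-pred

AgreeFrom-pred-switch : ∀ {q S T} →
  AgreeFrom q S T → lit S (pred q) ≢ lit T (pred q) → AgreeFrom (pred q) S (switch (pred q) T)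
AgreeFrom-pred-switch {q} {S} {T} S≈T differ-at-pred = AgreeFrom-pred
  (Agree-trans S≈T (Agree-sym (switch-Agree ≤⇒≢pred)))
  (trans (¬-not differ-at-pred) (sym (lit-switch-self (pred q) T)))

AgreeFrom-switch-exclusive : ∀ {q S U} → AgreeFrom q S U → ¬ AgreeFrom q (switch q S) U
AgreeFrom-switch-exclusive {q} {S} {U} S≈U switch[S]≈U =
  not-¬ refl (begin
    lit S q            ≡⟨ at S≈U q ≤-refl ⟩
    lit U q            ≡⟨ at switch[S]≈U q ≤-refl ⟨
    lit (switch q S) q ≡⟨ lit-switch-self q S ⟩
    not (lit S q)      ∎)
  where open ≡-Reasoning

AgreeFrom-unfold : ∀ {q S U} →
  AgreeFrom q S U ⇔ (AgreeFrom (pred q) S U ⊎ AgreeFrom (pred q) (switch (pred q) S) U)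
AgreeFrom-unfold {q} {S} {U} = mk⇔ unfold fold
  where
  pred[q]≤q : ∀ {r} → q ≤ r → pred q ≤ r
  pred[q]≤q = ≤-trans (<⇒≤ (pred<id q))
  unfold : AgreeFrom q S U → AgreeFrom (pred q) S U ⊎ AgreeFrom (pred q) (switch (pred q) S) U
  unfold S≈U with lit S (pred q) Bool.≟ lit U (pred q)
  ... | yes same   = inj₁ (AgreeFrom-pred S≈U same)
  ... | no  differ = inj₂ (Agree-sym (AgreeFrom-pred-switch (Agree-sym S≈U) (differ ∘ sym)))
  fold : AgreeFrom (pred q) S U ⊎ AgreeFrom (pred q) (switch (pred q) S) U → AgreeFrom q S U
  fold (inj₁ S≈U)         = Agree-mono pred[q]≤q S≈U
  fold (inj₂ switch[S]≈U) =
    Agree-trans (Agree-sym (switch-Agree ≤⇒≢pred)) (Agree-mono pred[q]≤q switch[S]≈U)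

·-e : ∀ S q → (S , q) · e ≡ (S , q)
·-e S q = cong₂ _,_ (△-identityʳ S) (+-identityʳ q)

·-a : ∀ S q → (S , q) · a ≡ (S , sucℤ q)
·-a S q = cong₂ _,_ (△-identityʳ S) (+-comm q (+ 1))

·-b : ∀ S q → (S , q) · b ≡ (switch q S , q)
·-b S q = cong₂ (λ p r → (switch p S , r)) (+-identityˡ q) (+-identityʳ q)

·-a⁻¹ : ∀ S q → (S , q) · a ⁻¹ ≡ (S , pred q)
·-a⁻¹ S q = cong₂ _,_ (△-identityʳ S) (+-comm q -[1+ 0 ])

·-a⁻¹b : ∀ S q → (S , q) · (a ⁻¹ · b) ≡ (switch (pred q) S , pred q)
·-a⁻¹b S q = cong (switch (pred q) S ,_) (+-comm q -[1+ 0 ])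

pow-a : ∀ k → pow a k ≡ (∅ , k)
pow-a (+ n)    = powℕ-a n
  where
  powℕ-a : ∀ n → powℕ a n ≡ (∅ , + n)
  powℕ-a zero    = refl
  powℕ-a (suc n) rewrite powℕ-a n = refl
pow-a -[1+ n ] = powℕ-a⁻¹ (suc n)
  where
  powℕ-a⁻¹ : ∀ n → powℕ (a ⁻¹) n ≡ (∅ , - + n)
  a⁻¹·[∅,-n] : ∀ n → a ⁻¹ · (∅ , - + n) ≡ (∅ , - + suc n)
  a⁻¹·[∅,-n] zero    = refl
  a⁻¹·[∅,-n] (suc n) = refl
  powℕ-a⁻¹ zero    = refl
  powℕ-a⁻¹ (suc n) = trans (cong (a ⁻¹ ·_) (powℕ-a⁻¹ n)) (a⁻¹·[∅,-n] n)

InCoset⇔≡ : ∀ {S₀ p₀ T r} → InCoset (S₀ , p₀) (T , r) ⇔ T ≡ S₀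
InCoset⇔≡ {S₀} {p₀} {T} {r} = mk⇔ (λ (k , eq) → cong proj₁ (trans eq (translate k))) same-lamps
  where
  translate : ∀ k → (S₀ , p₀) · pow a k ≡ (S₀ , p₀ + k)
  translate k rewrite pow-a k = cong (_, p₀ + k) (△-identityʳ S₀)
  p₀+[r-p₀]≡r : ∀ p r → p + (r - p) ≡ r
  p₀+[r-p₀]≡r = solve-∀
  same-lamps : T ≡ S₀ → InCoset (S₀ , p₀) (T , r)
  same-lamps refl = r - p₀ , sym (trans (translate (r - p₀)) (cong (S₀ ,_) (p₀+[r-p₀]≡r p₀ r)))

-- The shift of finite type

agreeBit markBit : Fin 4 → Bool
agreeBit zero                   = false
agreeBit (suc zero)             = true
agreeBit (suc (suc zero))       = false
agreeBit (suc (suc (suc zero))) = true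
markBit zero                   = false
markBit (suc zero)             = false
markBit (suc (suc zero))       = true
markBit (suc (suc (suc zero))) = true

symbol : Bool → Bool → Fin 4
symbol false false = # 0
symbol true  false = # 1
symbol false true  = # 2
symbol true  true  = # 3

agreeBit-symbol : ∀ y m → agreeBit (symbol y m) ≡ y
agreeBit-symbol false false = refl
agreeBit-symbol true  false = refl
agreeBit-symbol false true  = refl
agreeBit-symbol true  true  = refl

markBit-symbol : ∀ y m → markBit (symbol y m) ≡ m
markBit-symbol false false = refl
markBit-symbol true  false = refl
markBit-symbol false true  = refl
markBit-symbol true  true  = refl

record LocalRule (y y-b y-a⁻¹ y-a⁻¹b m m-a : Bool) : Set where
  field
    exclusive  : T y → ¬ T y-b
    unfold     : y ≡ y-a⁻¹ ∨ y-a⁻¹b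
    mark-shift : m ≡ m-a
    mark⇒agree : T m → T y

localRule? : ∀ y y-b y-a⁻¹ y-a⁻¹b m m-a → Dec (LocalRule y y-b y-a⁻¹ y-a⁻¹b m m-a)
localRule? y y-b y-a⁻¹ y-a⁻¹b m m-a = map′
  (λ (ex , un , ms , ma) → record { exclusive = ex ; unfold = un ; mark-shift = ms ; mark⇒agree = ma })
  (λ rule → let open LocalRule rule in exclusive , unfold , mark-shift , mark⇒agree)
  ((T? y →-dec ¬? (T? y-b)) ×-dec (y Bool.≟ y-a⁻¹ ∨ y-a⁻¹b) ×-dec (m Bool.≟ m-a) ×-dec (T? m →-dec T? y))

window : List L
window = e ∷ a ∷ b ∷ a ⁻¹ ∷ a ⁻¹ · b ∷ []

cosetSFT : SFTData
cosetSFT = record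
  { n = 4
  ; W = window
  ; P = λ y → does (localRule? (agreeBit (y (# 0))) (agreeBit (y (# 2)))
                               (agreeBit (y (# 3))) (agreeBit (y (# 4)))
                               (markBit (y (# 0))) (markBit (y (# 1))))
  }

RuleAt : (L → Fin 4) → FinSetℤ → ℤ → Set
RuleAt y S q = LocalRule (agreeBit (y (S , q))) (agreeBit (y (switch q S , q)))
                         (agreeBit (y (S , pred q))) (agreeBit (y (switch (pred q) S , pred q)))
                         (markBit (y (S , q))) (markBit (y (S , sucℤ q)))

T-does⇔ : ∀ {A : Set} (a? : Dec A) → T (does a?) ⇔ A
T-does⇔ (yes a)  = mk⇔ (λ _ → a) _
T-does⇔ (no ¬a) = mk⇔ (λ ()) ¬a

ruleAt? : ∀ y S q → Dec (RuleAt y S q)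
ruleAt? y S q = localRule? _ _ _ _ _ _

InSFT⇔RuleAt : ∀ y → InSFT cosetSFT y ⇔ (∀ S q → RuleAt y S q)
InSFT⇔RuleAt y = mk⇔
  (λ valid S q → to (T-does⇔ (ruleAt? y S q))
                      (from T-≡ (trans (sym (window-pattern S q)) (valid (S , q)))))
  (λ rules (S , q) → trans (window-pattern S q) (to T-≡ (from (T-does⇔ (ruleAt? y S q)) (rules S q))))
  where
  window-pattern : ∀ S q → P cosetSFT (λ i → y ((S , q) · lookup window i)) ≡ does (ruleAt? y S q)
  window-pattern S q rewrite ·-e S q | ·-a S q | ·-b S q | ·-a⁻¹ S q | ·-a⁻¹b S q = refl

markMap : (L → Fin 4) → (L → Bool)
markMap y h = markBit (y h)

-- Configurations of the shift of finite type

module ValidConfiguration (y : L → Fin 4) (valid : InSFT cosetSFT y) where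

  agrees marked : L → Bool
  agrees h = agreeBit (y h)
  marked h = markBit (y h)

  rule : ∀ S q → RuleAt y S q
  rule = to (InSFT⇔RuleAt y) valid

  open module Rule {S} {q} = LocalRule (rule S q)

  marked-coset-invariant : ∀ S q r → marked (S , q) ≡ marked (S , r)
  marked-coset-invariant S = sucℤ-invariant⇒constant (λ q → marked (S , q)) (λ _ → mark-shift)

  agrees-fibre-below : ∀ B q {S T} →
    AgreeFrom q S T → AgreeBelow B S T → agrees (S , q) ≡ agrees (T , q)
  agrees-fibre-below B = ℤ-induction-above B Fibre base step
    where
    Fibre : ℤ → Set
    Fibre q = ∀ {S T} → AgreeFrom q S T → AgreeBelow B S T → agrees (S , q) ≡ agrees (T , q)

    base : ∀ {q} → q ≤ B → Fibre q
    base {q} q≤B {S} {T} S≈T-from S≈T-below = cong (λ U → agrees (U , q)) (lit-ext everywhere)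
      where
      everywhere : ∀ r → lit S r ≡ lit T r
      everywhere r with r <? B
      ... | yes r<B = at S≈T-below r r<B
      ... | no  r≮B = at S≈T-from r (≤-trans q≤B (≮⇒≥ r≮B))

    step : ∀ {q} → B < q → Fibre (pred q) → Fibre q
    step {q} B<q ih {S} {T} S≈T-from S≈T-below = begin
      agrees (S , q)                     ≡⟨ unfold ⟩
      agrees (S , p) ∨ agrees (S′ , p)   ≡⟨ by-lamp-at-p (lit S p Bool.≟ lit T p) ⟩
      agrees (T , p) ∨ agrees (T′ , p)   ≡⟨ unfold ⟨
      agrees (T , q)                     ∎
      where
      open ≡-Reasoning
      p : ℤ
      p = pred q
      S′ T′ : FinSetℤ
      S′ = switch p S
      T′ = switch p T
      p∉below : ∀ {r} → r < B → r ≢ p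
      p∉below r<B = <⇒≢ (<-≤-trans r<B (i<j⇒i≤pred[j] B<q))
      by-lamp-at-p : Dec (lit S p ≡ lit T p) →
                     agrees (S , p) ∨ agrees (S′ , p) ≡ agrees (T , p) ∨ agrees (T′ , p)
      by-lamp-at-p (yes same) = cong₂ _∨_
        (ih (AgreeFrom-pred S≈T-from same) S≈T-below)
        (ih (Agree-switch (AgreeFrom-pred S≈T-from same)) (Agree-switch S≈T-below))
      by-lamp-at-p (no differ) = trans (cong₂ _∨_
        (ih (AgreeFrom-pred-switch S≈T-from differ)
            (Agree-trans S≈T-below (Agree-sym (switch-Agree p∉below))))
        (ih (Agree-sym (AgreeFrom-pred-switch (Agree-sym S≈T-from) (differ ∘ sym)))
            (Agree-trans (switch-Agree p∉below) S≈T-below)))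
        (∨-comm (agrees (T′ , p)) (agrees (T , p)))

  agrees-fibre : ∀ q {S T} → AgreeFrom q S T → agrees (S , q) ≡ agrees (T , q)
  agrees-fibre q {S} {T} S≈T-from = agrees-fibre-below (B₁ ⊓ B₂) q S≈T-from (mkAgree below)
    where
    B₁ B₂ : ℤ
    B₁ = proj₁ (lit-bounded-below S)
    B₂ = proj₁ (lit-bounded-below T)
    below : ∀ r → r < B₁ ⊓ B₂ → lit S r ≡ lit T r
    below r r<B = trans (proj₂ (lit-bounded-below S) (<-≤-trans r<B (i⊓j≤i B₁ B₂)))
                        (sym (proj₂ (lit-bounded-below T) (<-≤-trans r<B (i⊓j≤j B₁ B₂))))

  agrees-everywhere-unique : ∀ {S₀ S₁} →
    (∀ q → T (agrees (S₀ , q))) → (∀ q → T (agrees (S₁ , q))) → S₀ ≡ S₁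
  agrees-everywhere-unique {S₀} {S₁} S₀-agrees S₁-agrees =
    lit-ext λ r → at (ℤ-induction-below U (λ q → AgreeFrom q S₀ S₁) top step r) r ≤-refl
    where
    U₀ U₁ U : ℤ
    U₀ = proj₁ (lit-bounded-above S₀)
    U₁ = proj₁ (lit-bounded-above S₁)
    U  = U₀ ⊔ U₁
    top : ∀ {q} → U ≤ q → AgreeFrom q S₀ S₁
    top U≤q = mkAgree λ r q≤r → let U≤r = ≤-trans U≤q q≤r in
      trans (proj₂ (lit-bounded-above S₀) (i⊔j≤k⇒i≤k U₀ U₁ U≤r))
            (sym (proj₂ (lit-bounded-above S₁) (i⊔j≤k⇒j≤k U₀ U₁ U≤r)))
    step : ∀ {q} → AgreeFrom q S₀ S₁ → AgreeFrom (pred q) S₀ S₁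
    step {q} S₀≈S₁ with lit S₀ (pred q) Bool.≟ lit S₁ (pred q)
    ... | yes same   = AgreeFrom-pred S₀≈S₁ same
    ... | no  differ =
      contradiction (subst T fibre-at-pred (S₁-agrees (pred q))) (exclusive (S₀-agrees (pred q)))
      where
      fibre-at-pred : agrees (S₁ , pred q) ≡ agrees (switch (pred q) S₀ , pred q)
      fibre-at-pred = agrees-fibre (pred q) (AgreeFrom-pred-switch (Agree-sym S₀≈S₁) (differ ∘ sym))

  marked⇔≡ : ∀ {S₀ p₀} → T (marked (S₀ , p₀)) → ∀ S q → T (marked (S , q)) ⇔ S ≡ S₀
  marked⇔≡ {S₀} {p₀} m₀ S q =
    mk⇔ (λ m → agrees-everywhere-unique (agrees-everywhere m) (agrees-everywhere m₀))
        (λ { refl → subst T (marked-coset-invariant S₀ p₀ q) m₀ })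
    where
    agrees-everywhere : ∀ {S p} → T (marked (S , p)) → ∀ q → T (agrees (S , q))
    agrees-everywhere {S} {p} m q = mark⇒agree (subst T (marked-coset-invariant S p q) m)

-- Realizing a coset indicator

module Realization (em : ExcludedMiddle 0ℓ) (S₀ : FinSetℤ) where

  configuration : L → Fin 4
  configuration (S , q) = symbol (does (em {AgreeFrom q S S₀})) (does (em {S ≡ S₀}))

  agreeBit-configuration : ∀ S q → agreeBit (configuration (S , q)) ≡ does (em {AgreeFrom q S S₀})
  agreeBit-configuration S q = agreeBit-symbol (does em) (does em)

  markBit-configuration : ∀ S q → markBit (configuration (S , q)) ≡ does (em {S ≡ S₀})
  markBit-configuration S q = markBit-symbol (does em) (does em)

  configuration-rule : ∀ S q → RuleAt configuration S q
  configuration-rule S q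
    rewrite agreeBit-configuration S q | agreeBit-configuration (switch q S) q
          | agreeBit-configuration S (pred q) | agreeBit-configuration (switch (pred q) S) (pred q)
          | markBit-configuration S q | markBit-configuration S (sucℤ q)
    = record
    { exclusive  = λ S≈S₀ → AgreeFrom-switch-exclusive (to (T-does⇔ em) S≈S₀) ∘ to (T-does⇔ em)
    ; unfold     = does-⇔ AgreeFrom-unfold em (em ⊎-dec em)
    ; mark-shift = refl
    ; mark⇒agree = from (T-does⇔ em) ∘ ≡⇒AgreeFrom ∘ to (T-does⇔ em)
    }
    where
    ≡⇒AgreeFrom : S ≡ S₀ → AgreeFrom q S S₀
    ≡⇒AgreeFrom refl = Agree-refl

  configuration-valid : InSFT cosetSFT configuration
  configuration-valid = from (InSFT⇔RuleAt configuration) configuration-rule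

markMap-continuous : ContinuousOn cosetSFT markMap
markMap-continuous y _ h = h ∷ [] , λ y′ _ y′≈y → cong markBit (y′≈y h (here refl))

markMap-equivariant : EquivariantOn cosetSFT markMap
markMap-equivariant _ _ _ _ = refl

X⇒image : ExcludedMiddle 0ℓ → ∀ z → X z → InImage cosetSFT markMap z
X⇒image em z (inj₂ z≡0) = (λ _ → # 0) , (λ _ → refl) , λ h → sym (z≡0 h)
X⇒image em z (inj₁ ((S₀ , p₀) , z≡1-coset)) = configuration , configuration-valid , marks-coset
  where
  open Realization em S₀
  marks-coset : ∀ h → markMap configuration h ≡ z h
  marks-coset (S , q) = trans (markBit-configuration S q) (sym (does-⇔ coset-iff (T? (z (S , q))) em))
    where
    coset-iff : T (z (S , q)) ⇔ S ≡ S₀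
    coset-iff = ⇔.trans T-≡ (⇔.trans (mk⇔ (proj₁ (z≡1-coset _)) (proj₂ (z≡1-coset _))) InCoset⇔≡)

image⇒X : ExcludedMiddle 0ℓ → ∀ z → InImage cosetSFT markMap z → X z
image⇒X em z (y , valid , y↦z) with em {∃ λ h → T (markMap y h)}
... | no nothing-marked =
  inj₂ λ h → trans (sym (y↦z h)) (dec-false (T? (markMap y h)) (nothing-marked ∘ (h ,_)))
... | yes ((S₀ , p₀) , m₀) = inj₁ ((S₀ , p₀) , λ h → to (coset-iff h) , from (coset-iff h))
  where
  open ValidConfiguration y valid
  coset-iff : ∀ h → z h ≡ true ⇔ InCoset (S₀ , p₀) h
  coset-iff (S , q) rewrite sym (y↦z (S , q)) =
    ⇔.trans (⇔.sym T-≡) (⇔.trans (marked⇔≡ m₀ S q) (⇔.sym InCoset⇔≡))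

proposition6p4 : ExcludedMiddle 0ℓ → Sofic X
proposition6p4 em =
  cosetSFT , markMap , markMap-continuous , markMap-equivariant , λ z → X⇒image em z , image⇒X em z
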